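{- Let $m\in\mathbb{Z}_{>0}$. The set $$B(m)=\left\{\mu\in\Lambda(m):\mu_1+\mu_2=m+2,\ \binom{m}{\mu_1-1}\not\equiv0\pmod p\right\}$$ is the set of minimal elements of $\Lambda(m)\setminus\Gamma(m)$ (with respect to the componentwise order). Hence $\Lambda(m)\setminus\Gamma(m)=\mathcal{U}(B(m))$.
   Context: Let $p$ be a prime, $\mathbb{F}=\mathbb{F}_p$, $S=\mathbb{F}[x,y]$, $\mathrm{Der}_S=S\partial_x\oplus S\partial_y$. Let $\mathcal{A}=\{H_1,H_2,H_3\}$ with $H_1=\ker x$, $H_2=\ker y$, $H_3=\ker(x+y)$, $\alpha_1=x,\alpha_2=y,\alpha_3=x+y$. For $\mu=(\mu_1,\mu_2,\mu_3)\in\mathbb{Z}_{\ge0}^3$, $D(\mathcal{A},\mu)=\{\theta\in\mathrm{Der}_S:\theta(\alpha_i)\in\alpha_i^{\mu_i}S,\ i=1,2,3\}$. Let $\Lambda(m)=\{\mu\in\mathbb{Z}_{\ge0}^3:\mu_3=m\}$, partially ordered componentwise ($\mu\subseteq\nu$ iff $\mu_i\le\nu_i$ for all $i$). For $\mu\in\Lambda(m)$ let $\psi_\mu=\sum_{j=\mu_1}^{m}\binom{m}{j}x^jy^{m-j}\partial_x+\sum_{j=0}^{\mu_1-1}\binom{m}{j}x^jy^{m-j}\partial_y$ (binomial coefficients read in $\mathbb{F}_p$; empty sums are zero) and $\psi'_\mu=x^{\mu_1}y^{\mu_2}(\partial_y-\partial_x)$, and let $\Gamma(m)=\{\mu\in\Lambda(m):\{\psi_\mu,\psi'_\mu\}\text{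 is a basis for }D(\mathcal{A},\mu)\}$. For $T\subseteq\Lambda(m)$, $\mathcal{U}(T)=\{\mu\in\Lambda(m):\nu\subseteq\mu\text{ for some }\nu\in T\}$ is the upper set generated by $T$. -}

module Defs where

open import Data.Nat as ℕ using (ℕ; zero; suc; _∸_; _≤_)
open import Data.Nat.Combinatorics using (_C_)
open import Data.Integer as ℤ using (ℤ; +_; 0ℤ)
open import Data.Integer.Divisibility as ℤD using ()
open import Data.List using (List; []; _∷_; map; foldr; upTo; replicate)
open import Data.Product using (Σ; _×_; _,_; ∃; proj₁; proj₂)
open import Relation.Binary.PropositionalEquality using (_≡_)
open import Relation.Nullary using (¬_)

-- Polynomials.  The base field F_p is modelled as ℤ modulo p:
-- polynomials are written with integer coefficients and compared
-- coefficientwise modulo p (so S = F_p[x,y] = ℤ[x,y] / (p)).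

-- univariate: [a₀, a₁, …] = a₀ + a₁ y + a₂ y² + …
P1 : Set
P1 = List ℤ

add1 : P1 → P1 → P1
add1 [] q = q
add1 (a ∷ p) [] = a ∷ p
add1 (a ∷ p) (b ∷ q) = (a ℤ.+ b) ∷ add1 p q

scale1 : ℤ → P1 → P1
scale1 c = map (c ℤ.*_)

mul1 : P1 → P1 → P1
mul1 [] q = []
mul1 (a ∷ p) q = add1 (scale1 a q) (0ℤ ∷ mul1 p q)

-- bivariate: [f₀, f₁, …] = f₀(y) + f₁(y) x + f₂(y) x² + …
Poly : Set
Poly = List P1

add2 : Poly → Poly → Poly
add2 [] q = q
add2 (a ∷ p) [] = a ∷ p
add2 (a ∷ p) (b ∷ q) = add1 a b ∷ add2 p q

mul2 : Poly → Poly → Poly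
mul2 [] q = []
mul2 (a ∷ p) q = add2 (map (mul1 a) q) ([] ∷ mul2 p q)

neg2 : Poly → Poly
neg2 = map (map (λ a → ℤ.- a))

zeroP : Poly
zeroP = []

-- c · x^i y^j
mono : ℤ → ℕ → ℕ → Poly
mono c i j = replicate i [] Data.List.++ ((replicate j 0ℤ Data.List.++ (c ∷ [])) ∷ [])
  where import Data.List

X Y : Poly
X = mono (+ 1) 1 0
Y = mono (+ 1) 0 1

powP : Poly → ℕ → Poly
powP f zero = mono (+ 1) 0 0
powP f (suc n) = mul2 f (powP f n)

coeff1 : P1 → ℕ → ℤ
coeff1 [] j = 0ℤ
coeff1 (a ∷ p) zero = a
coeff1 (a ∷ p) (suc j) = coeff1 p j

coeff : Poly → ℕ → ℕ → ℤ
coeff [] i j = 0ℤ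
coeff (a ∷ f) zero j = coeff1 a j
coeff (a ∷ f) (suc i) j = coeff f i j

_≈[_]_ : Poly → ℕ → Poly → Set
f ≈[ p ] g = ∀ i j → (+ p) ℤD.∣ (coeff f i j ℤ.- coeff g i j)

Divides : ℕ → Poly → Poly → Set
Divides p a f = Σ Poly λ q → f ≈[ p ] mul2 a q

sumP : List ℕ → (ℕ → Poly) → Poly
sumP js t = foldr (λ j acc → add2 (t j) acc) zeroP js

-- Derivations θ = f ∂x + g ∂y, represented as the pair (f , g).

Der : Set
Der = Poly × Poly

_≈D[_]_ : Der → ℕ → Der → Set
(f , g) ≈D[ p ] (f' , g') = (f ≈[ p ] f') × (g ≈[ p ] g')

lin : Poly → Der → Poly → Der → Der
lin a (f , g) b (f' , g') = add2 (mul2 a f) (mul2 b f') , add2 (mul2 a g) (mul2 b g')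

zeroD : Der
zeroD = zeroP , zeroP

Mult : Set
Mult = ℕ × ℕ × ℕ

μ₁ μ₂ μ₃ : Mult → ℕ
μ₁ (a , b , c) = a
μ₂ (a , b , c) = b
μ₃ (a , b , c) = c

-- θ ∈ D(A, μ):  θ(x) ∈ x^μ₁ S, θ(y) ∈ y^μ₂ S, θ(x+y) ∈ (x+y)^μ₃ S
InD : ℕ → Mult → Der → Set
InD p μ (f , g) =
  Divides p (powP X (μ₁ μ)) f ×
  Divides p (powP Y (μ₂ μ)) g ×
  Divides p (powP (add2 X Y) (μ₃ μ)) (add2 f g)

IsBasis : ℕ → Mult → Der → Der → Set
IsBasis p μ θ₁ θ₂ =
  InD p μ θ₁ × InD p μ θ₂ ×
  (∀ θ → InD p μ θ → Σ Poly λ a → Σ Poly λ b → θ ≈D[ p ] lin a θ₁ b θ₂) ×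
  (∀ a b → lin a θ₁ b θ₂ ≈D[ p ] zeroD → (a ≈[ p ] zeroP) × (b ≈[ p ] zeroP))

InΛ : ℕ → Mult → Set
InΛ m μ = μ₃ μ ≡ m

_⊆μ_ : Mult → Mult → Set
μ ⊆μ ν = (μ₁ μ ≤ μ₁ ν) × (μ₂ μ ≤ μ₂ ν) × (μ₃ μ ≤ μ₃ ν)

ψ : ℕ → Mult → Der
ψ m μ =
  sumP (map (μ₁ μ ℕ.+_) (upTo (suc m ∸ μ₁ μ))) (λ j → mono (+ (m C j)) j (m ∸ j)) ,
  sumP (upTo (μ₁ μ)) (λ j → mono (+ (m C j)) j (m ∸ j))

ψ' : Mult → Der
ψ' μ = neg2 (mono (+ 1) (μ₁ μ) (μ₂ μ)) , mono (+ 1) (μ₁ μ) (μ₂ μ)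

InΓ : ℕ → ℕ → Mult → Set
InΓ p m μ = InΛ m μ × IsBasis p μ (ψ m μ) (ψ' μ)

InΛ∖Γ : ℕ → ℕ → Mult → Set
InΛ∖Γ p m μ = InΛ m μ × ¬ IsBasis p μ (ψ m μ) (ψ' μ)

-- B(m): μ₁ + μ₂ = m + 2 and binom(m, μ₁ − 1) ≢ 0 mod p
-- (μ₁ − 1 is an honest integer: for μ₁ = 0 the binomial is 0, so μ₁ = suc k)
InB : ℕ → ℕ → Mult → Set
InB p m μ = InΛ m μ × (μ₁ μ ℕ.+ μ₂ μ ≡ m ℕ.+ 2) ×
  Σ ℕ λ k → (μ₁ μ ≡ suc k) × ¬ (p ℕ.∣ (m C k))
  where import Data.Nat.Divisibility as ℕ

Minimal : (Mult → Set) → Mult → Set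
Minimal P μ = P μ × (∀ ν → P ν → ν ⊆μ μ → ν ≡ μ)

InU : ℕ → (Mult → Set) → Mult → Set
InU m T μ = InΛ m μ × Σ Mult λ ν → T ν × (ν ⊆μ μ)

{-# OPTIONS --safe #-}
module Submission where

-- Write μ = (a, b, m) and ψ_μ = (ψˣ, ψʸ), so that ψˣ + ψʸ = (x + y)^m.  Always ψˣ ∈ x^a S and
-- ψ'_μ ∈ D(A, μ), so ψ_μ ∈ D(A, μ) iff y^b divides ψʸ = Σ_{k<a} C(m,k) x^k y^(m-k), i.e. iff
-- p ∣ C(m,k) whenever k < a and m - k < b.  In that case {ψ_μ, ψ'_μ} is a basis: for θ = (f, g) in
-- D(A, μ) with f + g = q (x + y)^m, the polynomial h = g - q ψʸ is divisible by y^b, and by x^a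
-- since h ≡ -(f - q ψˣ); so h = x^a y^b B and θ = q ψ_μ + B ψ'_μ.  Independence holds because
-- multiplication by (x + y)^m is injective.  Hence μ ∉ Γ(m) iff μ ⊇ (k + 1, m + 1 - k, m) for some k
-- with p ∤ C(m,k), i.e. Λ(m) ∖ Γ(m) = U(B(m)).  Finally μ₁ + μ₂ = m + 2 on B(m), so B(m) is an
-- antichain, and an antichain is the set of minimal elements of the upper set it generates.

open import Defs
open import Data.Bool using (true; false; if_then_else_; T)
open import Data.Empty using (⊥-elim)
open import Data.Integer as ℤ using (ℤ; +_; 0ℤ; _+_; _*_; -_; _-_)
import Data.Integer.Divisibility as ℤD
import Data.Integer.Divisibility.Signed as S
import Data.Integer.Properties as ℤ
open import Data.Integer.Tactic.RingSolver using (solve-∀)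
open import Data.List using ([]; _∷_; map; drop; applyUpTo; upTo)
open import Data.List.Properties using (map-upTo)
open import Data.Nat as ℕ using (ℕ; zero; suc; _<_; _≤_; _∸_; z≤n; s≤s)
open import Data.Nat.Combinatorics using (_C_; nCk+nC[k+1]≡[n+1]C[k+1]; k>n⇒nCk≡0)
import Data.Nat.Divisibility as ℕD
open import Data.Nat.Primality using (Prime)
import Data.Nat.Properties as ℕ
open import Data.Product using (Σ; ∃; _×_; _,_; proj₁; proj₂)
open import Data.Sum using (_⊎_; inj₁; inj₂)
open import Function.Base using (_∘_)
open import Function.Bundles using (_⇔_; mk⇔; Equivalence)
open import Level using (0ℓ)
open import Relation.Binary.Bundles using (Setoid)
open import Relation.Binary.PropositionalEquality
import Relation.Binary.Reasoning.Setoid as SetoidReasoning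
open import Relation.Nullary using (¬_; yes; no; ¬?; _×-dec_)
open import Relation.Nullary.Decidable using (decidable-stable)
open import Algebra.Properties.CommutativeSemigroup ℤ.+-commutativeSemigroup
  using (x∙yz≈y∙xz; interchange)

infix 4 _≐₁_ _≐_

_≐₁_ : P1 → P1 → Set
r ≐₁ s = ∀ j → coeff1 r j ≡ coeff1 s j

_≐_ : Poly → Poly → Set
f ≐ g = ∀ i j → coeff f i j ≡ coeff g i j

∷-cong₁ : ∀ c {r s} → r ≐₁ s → (c ∷ r) ≐₁ (c ∷ s)
∷-cong₁ c e zero    = refl
∷-cong₁ c e (suc j) = e j

coeff1-add1 : ∀ r s j → coeff1 (add1 r s) j ≡ coeff1 r j + coeff1 s j
coeff1-add1 []      s       j       = sym (ℤ.+-identityˡ _)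
coeff1-add1 (a ∷ r) []      j       = sym (ℤ.+-identityʳ _)
coeff1-add1 (a ∷ r) (b ∷ s) zero    = refl
coeff1-add1 (a ∷ r) (b ∷ s) (suc j) = coeff1-add1 r s j

coeff1-scale1 : ∀ c r j → coeff1 (scale1 c r) j ≡ c * coeff1 r j
coeff1-scale1 c []      j       = sym (ℤ.*-zeroʳ c)
coeff1-scale1 c (a ∷ r) zero    = refl
coeff1-scale1 c (a ∷ r) (suc j) = coeff1-scale1 c r j

coeff1-mul1-∷ˡ : ∀ c r s j → coeff1 (mul1 (c ∷ r) s) j ≡ c * coeff1 s j + coeff1 (0ℤ ∷ mul1 r s) j
coeff1-mul1-∷ˡ c r s j =
  trans (coeff1-add1 (scale1 c s) (0ℤ ∷ mul1 r s) j) (cong (_+ _) (coeff1-scale1 c s j))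

mul1-zeroʳ : ∀ r j → coeff1 (mul1 r []) j ≡ 0ℤ
mul1-zeroʳ []      j       = refl
mul1-zeroʳ (c ∷ r) zero    = trans (coeff1-mul1-∷ˡ c r [] zero) (trans (ℤ.+-identityʳ _) (ℤ.*-zeroʳ c))
mul1-zeroʳ (c ∷ r) (suc j) = trans (coeff1-mul1-∷ˡ c r [] (suc j)) (cong₂ _+_ (ℤ.*-zeroʳ c) (mul1-zeroʳ r j))

coeff1-mul1-∷ʳ : ∀ r c s j → coeff1 (mul1 r (c ∷ s)) j ≡ c * coeff1 r j + coeff1 (0ℤ ∷ mul1 r s) j
coeff1-mul1-∷ʳ []      c s zero    = sym (trans (ℤ.+-identityʳ _) (ℤ.*-zeroʳ c))
coeff1-mul1-∷ʳ []      c s (suc j) = sym (trans (ℤ.+-identityʳ _) (ℤ.*-zeroʳ c))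
coeff1-mul1-∷ʳ (a ∷ r) c s zero    = trans (coeff1-mul1-∷ˡ a r (c ∷ s) zero) (cong (_+ 0ℤ) (ℤ.*-comm a c))
coeff1-mul1-∷ʳ (a ∷ r) c s (suc j) = begin
  coeff1 (mul1 (a ∷ r) (c ∷ s)) (suc j)                        ≡⟨ coeff1-mul1-∷ˡ a r (c ∷ s) (suc j) ⟩
  a * coeff1 s j + coeff1 (mul1 r (c ∷ s)) j                   ≡⟨ cong (_+_ (a * coeff1 s j)) (coeff1-mul1-∷ʳ r c s j) ⟩
  a * coeff1 s j + (c * coeff1 r j + coeff1 (0ℤ ∷ mul1 r s) j) ≡⟨ x∙yz≈y∙xz (a * coeff1 s j) (c * coeff1 r j) _ ⟩
  c * coeff1 r j + (a * coeff1 s j + coeff1 (0ℤ ∷ mul1 r s) j) ≡⟨ cong (_+_ (c * coeff1 r j)) (sym (coeff1-mul1-∷ˡ a r s j)) ⟩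
  c * coeff1 r j + coeff1 (mul1 (a ∷ r) s) j                   ∎
  where open ≡-Reasoning

mul1-comm : ∀ r s → mul1 r s ≐₁ mul1 s r
mul1-comm []      s j = sym (mul1-zeroʳ s j)
mul1-comm (c ∷ r) s j = begin
  coeff1 (mul1 (c ∷ r) s) j                      ≡⟨ coeff1-mul1-∷ˡ c r s j ⟩
  c * coeff1 s j + coeff1 (0ℤ ∷ mul1 r s) j      ≡⟨ cong (_+_ (c * coeff1 s j)) (∷-cong₁ 0ℤ (mul1-comm r s) j) ⟩
  c * coeff1 s j + coeff1 (0ℤ ∷ mul1 s r) j      ≡⟨ coeff1-mul1-∷ʳ s c r j ⟨
  coeff1 (mul1 s (c ∷ r)) j                      ∎
  where open ≡-Reasoning

mul1-congʳ : ∀ r {s s'} → s ≐₁ s' → mul1 r s ≐₁ mul1 r s'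
mul1-congʳ []      e j = refl
mul1-congʳ (c ∷ r) {s} {s'} e j = begin
  coeff1 (mul1 (c ∷ r) s) j                  ≡⟨ coeff1-mul1-∷ˡ c r s j ⟩
  c * coeff1 s j + coeff1 (0ℤ ∷ mul1 r s) j  ≡⟨ cong₂ _+_ (cong (c *_) (e j)) (∷-cong₁ 0ℤ (mul1-congʳ r e) j) ⟩
  c * coeff1 s' j + coeff1 (0ℤ ∷ mul1 r s') j ≡⟨ coeff1-mul1-∷ˡ c r s' j ⟨
  coeff1 (mul1 (c ∷ r) s') j                 ∎
  where open ≡-Reasoning

-- `0ℤ ∷ add1 u v` is definitionally `add1 (0ℤ ∷ u) (0ℤ ∷ v)`.
mul1-distribˡ : ∀ r s t → mul1 r (add1 s t) ≐₁ add1 (mul1 r s) (mul1 r t)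
mul1-distribˡ []      s t j = refl
mul1-distribˡ (c ∷ r) s t j = begin
  coeff1 (mul1 (c ∷ r) (add1 s t)) j
    ≡⟨ coeff1-mul1-∷ˡ c r (add1 s t) j ⟩
  c * coeff1 (add1 s t) j + coeff1 (0ℤ ∷ mul1 r (add1 s t)) j
    ≡⟨ cong₂ _+_ (cong (c *_) (coeff1-add1 s t j)) (∷-cong₁ 0ℤ (mul1-distribˡ r s t) j) ⟩
  c * (coeff1 s j + coeff1 t j) + coeff1 (add1 (0ℤ ∷ mul1 r s) (0ℤ ∷ mul1 r t)) j
    ≡⟨ cong₂ _+_ (ℤ.*-distribˡ-+ c _ _) (coeff1-add1 (0ℤ ∷ mul1 r s) (0ℤ ∷ mul1 r t) j) ⟩
  (c * coeff1 s j + c * coeff1 t j) + (coeff1 (0ℤ ∷ mul1 r s) j + coeff1 (0ℤ ∷ mul1 r t) j)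
    ≡⟨ interchange (c * coeff1 s j) (c * coeff1 t j) _ _ ⟩
  (c * coeff1 s j + coeff1 (0ℤ ∷ mul1 r s) j) + (c * coeff1 t j + coeff1 (0ℤ ∷ mul1 r t) j)
    ≡⟨ cong₂ _+_ (coeff1-mul1-∷ˡ c r s j) (coeff1-mul1-∷ˡ c r t j) ⟨
  coeff1 (mul1 (c ∷ r) s) j + coeff1 (mul1 (c ∷ r) t) j
    ≡⟨ coeff1-add1 (mul1 (c ∷ r) s) (mul1 (c ∷ r) t) j ⟨
  coeff1 (add1 (mul1 (c ∷ r) s) (mul1 (c ∷ r) t)) j ∎
  where open ≡-Reasoning

row : Poly → ℕ → P1
row []      i       = []
row (r ∷ f) zero    = r
row (r ∷ f) (suc i) = row f i

coeff-row : ∀ f i j → coeff f i j ≡ coeff1 (row f i) j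
coeff-row []      i       j = refl
coeff-row (r ∷ f) zero    j = refl
coeff-row (r ∷ f) (suc i) j = coeff-row f i j

row-cong : ∀ {f g} → f ≐ g → ∀ i → row f i ≐₁ row g i
row-cong {f} {g} e i j = trans (sym (coeff-row f i j)) (trans (e i j) (coeff-row g i j))

[]∷-cong : ∀ {f g} → f ≐ g → ([] ∷ f) ≐ ([] ∷ g)
[]∷-cong e zero    j = refl
[]∷-cong e (suc i) j = e i j

coeff-[]∷[] : ∀ i j → coeff ([] ∷ []) i j ≡ 0ℤ
coeff-[]∷[] zero    j = refl
coeff-[]∷[] (suc i) j = refl

coeff-map : ∀ (h : P1 → P1) → (∀ j → coeff1 (h []) j ≡ 0ℤ) →
            ∀ f i j → coeff (map h f) i j ≡ coeff1 (h (row f i)) j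
coeff-map h h[] []      i       j = sym (h[] j)
coeff-map h h[] (r ∷ f) zero    j = refl
coeff-map h h[] (r ∷ f) (suc i) j = coeff-map h h[] f i j

coeff-add2 : ∀ f g i j → coeff (add2 f g) i j ≡ coeff f i j + coeff g i j
coeff-add2 []      g       i       j = sym (ℤ.+-identityˡ _)
coeff-add2 (r ∷ f) []      i       j = sym (ℤ.+-identityʳ _)
coeff-add2 (r ∷ f) (s ∷ g) zero    j = coeff1-add1 r s j
coeff-add2 (r ∷ f) (s ∷ g) (suc i) j = coeff-add2 f g i j

coeff-neg2 : ∀ f i j → coeff (neg2 f) i j ≡ - coeff f i j
coeff-neg2 []      i       j = refl
coeff-neg2 (r ∷ f) zero    j = coeff1-neg r j
  where
  coeff1-neg : ∀ r j → coeff1 (map -_ r) j ≡ - coeff1 r j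
  coeff1-neg []      j       = refl
  coeff1-neg (a ∷ r) zero    = refl
  coeff1-neg (a ∷ r) (suc j) = coeff1-neg r j
coeff-neg2 (r ∷ f) (suc i) j = coeff-neg2 f i j

coeff-mul2-∷ˡ : ∀ r f g i j → coeff (mul2 (r ∷ f) g) i j ≡ coeff1 (mul1 r (row g i)) j + coeff ([] ∷ mul2 f g) i j
coeff-mul2-∷ˡ r f g i j =
  trans (coeff-add2 (map (mul1 r) g) ([] ∷ mul2 f g) i j) (cong (_+ _) (coeff-map (mul1 r) (mul1-zeroʳ r) g i j))

mul2-zeroʳ : ∀ f i j → coeff (mul2 f []) i j ≡ 0ℤ
mul2-zeroʳ []      i       j = refl
mul2-zeroʳ (r ∷ f) zero    j = refl
mul2-zeroʳ (r ∷ f) (suc i) j = mul2-zeroʳ f i j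

coeff-mul2-∷ʳ : ∀ f s g i j → coeff (mul2 f (s ∷ g)) i j ≡ coeff1 (mul1 s (row f i)) j + coeff ([] ∷ mul2 f g) i j
coeff-mul2-∷ʳ []      s g i       j = sym (cong₂ _+_ (mul1-zeroʳ s j) (coeff-[]∷[] i j))
coeff-mul2-∷ʳ (r ∷ f) s g zero    j = trans (coeff-mul2-∷ˡ r f (s ∷ g) zero j) (cong (_+ 0ℤ) (mul1-comm r s j))
coeff-mul2-∷ʳ (r ∷ f) s g (suc i) j = begin
  coeff (mul2 (r ∷ f) (s ∷ g)) (suc i) j
    ≡⟨ coeff-mul2-∷ˡ r f (s ∷ g) (suc i) j ⟩
  coeff1 (mul1 r (row g i)) j + coeff (mul2 f (s ∷ g)) i j
    ≡⟨ cong (_+_ (coeff1 (mul1 r (row g i)) j)) (coeff-mul2-∷ʳ f s g i j) ⟩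
  coeff1 (mul1 r (row g i)) j + (coeff1 (mul1 s (row f i)) j + coeff ([] ∷ mul2 f g) i j)
    ≡⟨ x∙yz≈y∙xz (coeff1 (mul1 r (row g i)) j) (coeff1 (mul1 s (row f i)) j) _ ⟩
  coeff1 (mul1 s (row f i)) j + (coeff1 (mul1 r (row g i)) j + coeff ([] ∷ mul2 f g) i j)
    ≡⟨ cong (_+_ (coeff1 (mul1 s (row f i)) j)) (coeff-mul2-∷ˡ r f g i j) ⟨
  coeff1 (mul1 s (row f i)) j + coeff (mul2 (r ∷ f) g) i j ∎
  where open ≡-Reasoning

mul2-comm : ∀ f g → mul2 f g ≐ mul2 g f
mul2-comm []      g i j = sym (mul2-zeroʳ g i j)
mul2-comm (r ∷ f) g i j = begin
  coeff (mul2 (r ∷ f) g) i j                                  ≡⟨ coeff-mul2-∷ˡ r f g i j ⟩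
  coeff1 (mul1 r (row g i)) j + coeff ([] ∷ mul2 f g) i j
    ≡⟨ cong (_+_ (coeff1 (mul1 r (row g i)) j)) ([]∷-cong (mul2-comm f g) i j) ⟩
  coeff1 (mul1 r (row g i)) j + coeff ([] ∷ mul2 g f) i j     ≡⟨ coeff-mul2-∷ʳ g r f i j ⟨
  coeff (mul2 g (r ∷ f)) i j                                  ∎
  where open ≡-Reasoning

mul2-congʳ : ∀ f {g g'} → g ≐ g' → mul2 f g ≐ mul2 f g'
mul2-congʳ []      e i j = refl
mul2-congʳ (r ∷ f) {g} {g'} e i j = begin
  coeff (mul2 (r ∷ f) g) i j                                  ≡⟨ coeff-mul2-∷ˡ r f g i j ⟩
  coeff1 (mul1 r (row g i)) j + coeff ([] ∷ mul2 f g) i j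
    ≡⟨ cong₂ _+_ (mul1-congʳ r (row-cong {g} {g'} e i) j) ([]∷-cong (mul2-congʳ f e) i j) ⟩
  coeff1 (mul1 r (row g' i)) j + coeff ([] ∷ mul2 f g') i j   ≡⟨ coeff-mul2-∷ˡ r f g' i j ⟨
  coeff (mul2 (r ∷ f) g') i j                                 ∎
  where open ≡-Reasoning

mul2-congˡ : ∀ {f f'} g → f ≐ f' → mul2 f g ≐ mul2 f' g
mul2-congˡ {f} {f'} g e i j =
  trans (mul2-comm f g i j) (trans (mul2-congʳ g e i j) (mul2-comm g f' i j))

row-add2 : ∀ f g i → row (add2 f g) i ≐₁ add1 (row f i) (row g i)
row-add2 f g i j = begin
  coeff1 (row (add2 f g) i) j             ≡⟨ coeff-row (add2 f g) i j ⟨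
  coeff (add2 f g) i j                    ≡⟨ coeff-add2 f g i j ⟩
  coeff f i j + coeff g i j               ≡⟨ cong₂ _+_ (coeff-row f i j) (coeff-row g i j) ⟩
  coeff1 (row f i) j + coeff1 (row g i) j ≡⟨ coeff1-add1 (row f i) (row g i) j ⟨
  coeff1 (add1 (row f i) (row g i)) j     ∎
  where open ≡-Reasoning

-- `[] ∷ add2 u v` is definitionally `add2 ([] ∷ u) ([] ∷ v)`.
mul2-distribˡ : ∀ f g h → mul2 f (add2 g h) ≐ add2 (mul2 f g) (mul2 f h)
mul2-distribˡ []      g h i j = refl
mul2-distribˡ (r ∷ f) g h i j = begin
  coeff (mul2 (r ∷ f) (add2 g h)) i j
    ≡⟨ coeff-mul2-∷ˡ r f (add2 g h) i j ⟩
  coeff1 (mul1 r (row (add2 g h) i)) j + coeff ([] ∷ mul2 f (add2 g h)) i j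
    ≡⟨ cong₂ _+_ (trans (mul1-congʳ r (row-add2 g h i) j) (mul1-distribˡ r (row g i) (row h i) j))
                 ([]∷-cong (mul2-distribˡ f g h) i j) ⟩
  coeff1 (add1 (mul1 r (row g i)) (mul1 r (row h i))) j + coeff (add2 ([] ∷ mul2 f g) ([] ∷ mul2 f h)) i j
    ≡⟨ cong₂ _+_ (coeff1-add1 (mul1 r (row g i)) (mul1 r (row h i)) j) (coeff-add2 ([] ∷ mul2 f g) ([] ∷ mul2 f h) i j) ⟩
  (coeff1 (mul1 r (row g i)) j + coeff1 (mul1 r (row h i)) j) + (coeff ([] ∷ mul2 f g) i j + coeff ([] ∷ mul2 f h) i j)
    ≡⟨ interchange (coeff1 (mul1 r (row g i)) j) (coeff1 (mul1 r (row h i)) j) _ _ ⟩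
  (coeff1 (mul1 r (row g i)) j + coeff ([] ∷ mul2 f g) i j) + (coeff1 (mul1 r (row h i)) j + coeff ([] ∷ mul2 f h) i j)
    ≡⟨ cong₂ _+_ (coeff-mul2-∷ˡ r f g i j) (coeff-mul2-∷ˡ r f h i j) ⟨
  coeff (mul2 (r ∷ f) g) i j + coeff (mul2 (r ∷ f) h) i j
    ≡⟨ coeff-add2 (mul2 (r ∷ f) g) (mul2 (r ∷ f) h) i j ⟨
  coeff (add2 (mul2 (r ∷ f) g) (mul2 (r ∷ f) h)) i j ∎
  where open ≡-Reasoning

<⊎offset : ∀ a i → i < a ⊎ ∃ λ k → a ℕ.+ k ≡ i
<⊎offset a i with ℕ.<-≤-connex i a
... | inj₁ i<a = inj₁ i<a
... | inj₂ a≤i = inj₂ (ℕ.m≤n⇒∃[o]m+o≡n a≤i)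

data Position (a b : ℕ) : ℕ → ℕ → Set where
  outside : ∀ {i j} → i < a ⊎ j < b → Position a b i j
  inside  : ∀ k l → Position a b (a ℕ.+ k) (b ℕ.+ l)

position : ∀ a b i j → Position a b i j
position a b i j with <⊎offset a i | <⊎offset b j
... | inj₁ i<a        | _               = outside (inj₁ i<a)
... | inj₂ _          | inj₁ j<b        = outside (inj₂ j<b)
... | inj₂ (k , refl) | inj₂ (l , refl) = inside k l

coeff-mono-≢ˣ : ∀ c a b i j → a ≢ i → coeff (mono c a b) i j ≡ 0ℤ
coeff-mono-≢ˣ c zero    b zero    j a≢i = ⊥-elim (a≢i refl)
coeff-mono-≢ˣ c zero    b (suc i) j a≢i = refl
coeff-mono-≢ˣ c (suc a) b zero    j a≢i = refl
coeff-mono-≢ˣ c (suc a) b (suc i) j a≢i = coeff-mono-≢ˣ c a b i j (a≢i ∘ cong suc)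

coeff-mono-≢ʸ : ∀ c a b i j → b ≢ j → coeff (mono c a b) i j ≡ 0ℤ
coeff-mono-≢ʸ c zero    b       (suc i) j       b≢j = refl
coeff-mono-≢ʸ c (suc a) b       zero    j       b≢j = refl
coeff-mono-≢ʸ c (suc a) b       (suc i) j       b≢j = coeff-mono-≢ʸ c a b i j b≢j
coeff-mono-≢ʸ c zero    zero    zero    zero    b≢j = ⊥-elim (b≢j refl)
coeff-mono-≢ʸ c zero    zero    zero    (suc j) b≢j = refl
coeff-mono-≢ʸ c zero    (suc b) zero    zero    b≢j = refl
coeff-mono-≢ʸ c zero    (suc b) zero    (suc j) b≢j = coeff-mono-≢ʸ c zero b zero j (b≢j ∘ cong suc)

coeff-mono : ∀ c a b → coeff (mono c a b) a b ≡ c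
coeff-mono c (suc a) b       = coeff-mono c a b
coeff-mono c zero    (suc b) = coeff-mono c zero b
coeff-mono c zero    zero    = refl

yMono : ℤ → ℕ → P1
yMono c b = row (mono c 0 b) 0

coeff1-mul1-yMono-< : ∀ c b r j → j < b → coeff1 (mul1 (yMono c b) r) j ≡ 0ℤ
coeff1-mul1-yMono-< c (suc b) r zero    _         =
  trans (coeff1-mul1-∷ˡ 0ℤ (yMono c b) r zero) (ℤ.+-identityʳ (0ℤ * coeff1 r 0))
coeff1-mul1-yMono-< c (suc b) r (suc j) (s≤s j<b) =
  trans (coeff1-mul1-∷ˡ 0ℤ (yMono c b) r (suc j)) (cong (_+_ (0ℤ * coeff1 r (suc j))) (coeff1-mul1-yMono-< c b r j j<b))

coeff1-mul1-yMono-+ : ∀ c b r j → coeff1 (mul1 (yMono c b) r) (b ℕ.+ j) ≡ c * coeff1 r j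
coeff1-mul1-yMono-+ c zero    r zero    = trans (coeff1-mul1-∷ˡ c [] r zero) (ℤ.+-identityʳ _)
coeff1-mul1-yMono-+ c zero    r (suc j) = trans (coeff1-mul1-∷ˡ c [] r (suc j)) (ℤ.+-identityʳ _)
coeff1-mul1-yMono-+ c (suc b) r j =
  trans (coeff1-mul1-∷ˡ 0ℤ (yMono c b) r (suc b ℕ.+ j))
        (trans (ℤ.+-identityˡ _) (coeff1-mul1-yMono-+ c b r j))

coeff-mul2-[]∷ : ∀ f q i j → coeff (mul2 ([] ∷ f) q) i j ≡ coeff ([] ∷ mul2 f q) i j
coeff-mul2-[]∷ f q i j = trans (coeff-mul2-∷ˡ [] f q i j) (ℤ.+-identityˡ _)

coeff-mono-mul2-outside : ∀ c a b q i j → i < a ⊎ j < b → coeff (mul2 (mono c a b) q) i j ≡ 0ℤ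
coeff-mono-mul2-outside c (suc a) b q zero    j _                = coeff-mul2-[]∷ (mono c a b) q 0 j
coeff-mono-mul2-outside c (suc a) b q (suc i) j i<a⊎j<b          =
  trans (coeff-mul2-[]∷ (mono c a b) q (suc i) j) (coeff-mono-mul2-outside c a b q i j (shrink i<a⊎j<b))
  where
  shrink : suc i < suc a ⊎ j < b → i < a ⊎ j < b
  shrink (inj₁ (s≤s i<a)) = inj₁ i<a
  shrink (inj₂ j<b)       = inj₂ j<b
coeff-mono-mul2-outside c zero    b q i       j (inj₂ j<b)       =
  trans (coeff-mul2-∷ˡ (yMono c b) [] q i j)
        (cong₂ _+_ (coeff1-mul1-yMono-< c b (row q i) j j<b) (coeff-[]∷[] i j))

coeff-mono-mul2-+ : ∀ c a b q i j → coeff (mul2 (mono c a b) q) (a ℕ.+ i) (b ℕ.+ j) ≡ c * coeff q i j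
coeff-mono-mul2-+ c (suc a) b q i j =
  trans (coeff-mul2-[]∷ (mono c a b) q (suc a ℕ.+ i) (b ℕ.+ j)) (coeff-mono-mul2-+ c a b q i j)
coeff-mono-mul2-+ c zero    b q i j = begin
  coeff (mul2 (mono c 0 b) q) i (b ℕ.+ j)                        ≡⟨ coeff-mul2-∷ˡ (yMono c b) [] q i (b ℕ.+ j) ⟩
  coeff1 (mul1 (yMono c b) (row q i)) (b ℕ.+ j) + coeff ([] ∷ []) i (b ℕ.+ j)
    ≡⟨ cong₂ _+_ (coeff1-mul1-yMono-+ c b (row q i) j) (coeff-[]∷[] i (b ℕ.+ j)) ⟩
  c * coeff1 (row q i) j + 0ℤ                                    ≡⟨ ℤ.+-identityʳ _ ⟩
  c * coeff1 (row q i) j                                         ≡⟨ cong (c *_) (coeff-row q i j) ⟨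
  c * coeff q i j                                                ∎
  where open ≡-Reasoning

mul2-identityʳ : ∀ f → mul2 f (mono (+ 1) 0 0) ≐ f
mul2-identityʳ f i j =
  trans (mul2-comm f (mono (+ 1) 0 0) i j) (trans (coeff-mono-mul2-+ (+ 1) 0 0 f i j) (ℤ.*-identityˡ _))

coeff-mono-mul2-scale : ∀ c a b q i j → coeff (mul2 (mono c a b) q) i j ≡ c * coeff (mul2 (mono (+ 1) a b) q) i j
coeff-mono-mul2-scale c a b q i j with position a b i j
... | outside out = trans (coeff-mono-mul2-outside c a b q i j out)
                          (sym (trans (cong (c *_) (coeff-mono-mul2-outside (+ 1) a b q i j out)) (ℤ.*-zeroʳ c)))
... | inside k l  = trans (coeff-mono-mul2-+ c a b q k l)
                          (cong (c *_) (sym (trans (coeff-mono-mul2-+ (+ 1) a b q k l) (ℤ.*-identityˡ _))))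

neg2-mono : ∀ c a b → neg2 (mono c a b) ≐ mono (- c) a b
neg2-mono c a b i j with a ℕ.≟ i | b ℕ.≟ j
... | yes refl | yes refl = trans (coeff-neg2 (mono c a b) a b) (trans (cong -_ (coeff-mono c a b)) (sym (coeff-mono (- c) a b)))
... | no a≢i   | _        = trans (coeff-neg2 (mono c a b) i j)
                                  (trans (cong -_ (coeff-mono-≢ˣ c a b i j a≢i)) (sym (coeff-mono-≢ˣ (- c) a b i j a≢i)))
... | yes _    | no b≢j   = trans (coeff-neg2 (mono c a b) i j)
                                  (trans (cong -_ (coeff-mono-≢ʸ c a b i j b≢j)) (sym (coeff-mono-≢ʸ (- c) a b i j b≢j)))

coeff-mul2-neg2-mono : ∀ q a b i j → coeff (mul2 q (neg2 (mono (+ 1) a b))) i j ≡ - coeff (mul2 q (mono (+ 1) a b)) i j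
coeff-mul2-neg2-mono q a b i j = begin
  coeff (mul2 q (neg2 (mono (+ 1) a b))) i j    ≡⟨ mul2-comm q (neg2 (mono (+ 1) a b)) i j ⟩
  coeff (mul2 (neg2 (mono (+ 1) a b)) q) i j    ≡⟨ mul2-congˡ {neg2 (mono (+ 1) a b)} {mono (- + 1) a b} q (neg2-mono (+ 1) a b) i j ⟩
  coeff (mul2 (mono (- + 1) a b) q) i j         ≡⟨ coeff-mono-mul2-scale (- + 1) a b q i j ⟩
  - + 1 * coeff (mul2 (mono (+ 1) a b) q) i j   ≡⟨ ℤ.-1*i≡-i _ ⟩
  - coeff (mul2 (mono (+ 1) a b) q) i j         ≡⟨ cong -_ (mul2-comm (mono (+ 1) a b) q i j) ⟩
  - coeff (mul2 q (mono (+ 1) a b)) i j         ∎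
  where open ≡-Reasoning

monoQuotient : ℕ → ℕ → Poly → Poly
monoQuotient a b f = map (drop b) (drop a f)

coeff-monoQuotient : ∀ a b f i j → coeff (monoQuotient a b f) i j ≡ coeff f (a ℕ.+ i) (b ℕ.+ j)
coeff-monoQuotient a b f i j = begin
  coeff (map (drop b) (drop a f)) i j    ≡⟨ coeff-map (drop b) (drop-[] b) (drop a f) i j ⟩
  coeff1 (drop b (row (drop a f) i)) j   ≡⟨ coeff1-drop b (row (drop a f) i) j ⟩
  coeff1 (row (drop a f) i) (b ℕ.+ j)    ≡⟨ coeff-row (drop a f) i (b ℕ.+ j) ⟨
  coeff (drop a f) i (b ℕ.+ j)           ≡⟨ coeff-drop a f i (b ℕ.+ j) ⟩
  coeff f (a ℕ.+ i) (b ℕ.+ j)            ∎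
  where
  open ≡-Reasoning
  drop-[] : ∀ b j → coeff1 (drop b []) j ≡ 0ℤ
  drop-[] zero    j = refl
  drop-[] (suc b) j = refl
  coeff1-drop : ∀ b r j → coeff1 (drop b r) j ≡ coeff1 r (b ℕ.+ j)
  coeff1-drop zero    r       j = refl
  coeff1-drop (suc b) []      j = refl
  coeff1-drop (suc b) (c ∷ r) j = coeff1-drop b r j
  coeff-drop : ∀ a f i j → coeff (drop a f) i j ≡ coeff f (a ℕ.+ i) j
  coeff-drop zero    f       i j = refl
  coeff-drop (suc a) []      i j = refl
  coeff-drop (suc a) (r ∷ f) i j = coeff-drop a f i j

shiftˣ shiftʸ : (ℕ → ℕ → ℤ) → ℕ → ℕ → ℤ
shiftˣ F zero    j       = 0ℤ
shiftˣ F (suc i) j       = F i j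
shiftʸ F i       zero    = 0ℤ
shiftʸ F i       (suc j) = F i j

coeff-X-mul2 : ∀ q i j → coeff (mul2 X q) i j ≡ shiftˣ (coeff q) i j
coeff-X-mul2 q zero    j = coeff-mono-mul2-outside (+ 1) 1 0 q 0 j (inj₁ (s≤s z≤n))
coeff-X-mul2 q (suc i) j = trans (coeff-mono-mul2-+ (+ 1) 1 0 q i j) (ℤ.*-identityˡ _)

coeff-Y-mul2 : ∀ q i j → coeff (mul2 Y q) i j ≡ shiftʸ (coeff q) i j
coeff-Y-mul2 q i zero    = coeff-mono-mul2-outside (+ 1) 0 1 q i 0 (inj₂ (s≤s z≤n))
coeff-Y-mul2 q i (suc j) = trans (coeff-mono-mul2-+ (+ 1) 0 1 q i j) (ℤ.*-identityˡ _)

powP-X : ∀ n → powP X n ≐ mono (+ 1) n 0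
powP-X zero    i       j = refl
powP-X (suc n) zero    j = coeff-X-mul2 (powP X n) 0 j
powP-X (suc n) (suc i) j = trans (coeff-X-mul2 (powP X n) (suc i) j) (powP-X n i j)

powP-Y : ∀ n → powP Y n ≐ mono (+ 1) 0 n
powP-Y zero    i j       = refl
powP-Y (suc n) i zero    = trans (coeff-Y-mul2 (powP Y n) i 0) (sym (coeff-mono-≢ʸ (+ 1) 0 (suc n) i 0 λ ()))
powP-Y (suc n) i (suc j) = trans (coeff-Y-mul2 (powP Y n) i (suc j)) (trans (powP-Y n i j) (lift i))
  where
  lift : ∀ i → coeff (mono (+ 1) 0 n) i j ≡ coeff (mono (+ 1) 0 (suc n)) i (suc j)
  lift zero    = refl
  lift (suc i) = refl

coeff-X+Y-mul2 : ∀ q i j → coeff (mul2 (add2 X Y) q) i j ≡ shiftˣ (coeff q) i j + shiftʸ (coeff q) i j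
coeff-X+Y-mul2 q i j = begin
  coeff (mul2 (add2 X Y) q) i j             ≡⟨ mul2-comm (add2 X Y) q i j ⟩
  coeff (mul2 q (add2 X Y)) i j             ≡⟨ mul2-distribˡ q X Y i j ⟩
  coeff (add2 (mul2 q X) (mul2 q Y)) i j    ≡⟨ coeff-add2 (mul2 q X) (mul2 q Y) i j ⟩
  coeff (mul2 q X) i j + coeff (mul2 q Y) i j
    ≡⟨ cong₂ _+_ (trans (mul2-comm q X i j) (coeff-X-mul2 q i j)) (trans (mul2-comm q Y i j) (coeff-Y-mul2 q i j)) ⟩
  shiftˣ (coeff q) i j + shiftʸ (coeff q) i j ∎
  where open ≡-Reasoning

binomial : ℕ → ℕ → ℕ → ℤ
binomial n i j = if i ℕ.+ j ℕ.≡ᵇ n then + (n C i) else 0ℤ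

binomial-pascal : ∀ n i j → binomial (suc n) i j ≡ shiftˣ (binomial n) i j + shiftʸ (binomial n) i j
binomial-pascal n zero    zero    = refl
binomial-pascal n zero    (suc j) with j ℕ.≡ᵇ n
... | true  = refl
... | false = refl
binomial-pascal n (suc i) zero    with i ℕ.+ 0 ℕ.≡ᵇ n in i+0≡ᵇn
... | false = refl
... | true  = begin
  + (suc n C suc i)           ≡⟨ cong +_ (nCk+nC[k+1]≡[n+1]C[k+1] n i) ⟨
  + (n C i ℕ.+ n C suc i)     ≡⟨ cong (λ c → + (n C i ℕ.+ c)) (k>n⇒nCk≡0 n<1+i) ⟩
  + (n C i ℕ.+ 0)             ∎
  where
  open ≡-Reasoning
  n<1+i : n < suc i
  n<1+i = s≤s (ℕ.≤-reflexive (trans (sym (ℕ.≡ᵇ⇒≡ _ _ (subst T (sym i+0≡ᵇn) _))) (ℕ.+-identityʳ i)))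
binomial-pascal n (suc i) (suc j) rewrite ℕ.+-suc i j with suc (i ℕ.+ j) ℕ.≡ᵇ n
... | true  = cong +_ (sym (nCk+nC[k+1]≡[n+1]C[k+1] n i))
... | false = refl

coeff-powP-X+Y : ∀ n i j → coeff (powP (add2 X Y) n) i j ≡ binomial n i j
coeff-powP-X+Y zero    zero    zero    = refl
coeff-powP-X+Y zero    zero    (suc j) = refl
coeff-powP-X+Y zero    (suc i) j       = refl
coeff-powP-X+Y (suc n) i       j       = begin
  coeff (mul2 (add2 X Y) (powP (add2 X Y) n)) i j                              ≡⟨ coeff-X+Y-mul2 (powP (add2 X Y) n) i j ⟩
  shiftˣ (coeff (powP (add2 X Y) n)) i j + shiftʸ (coeff (powP (add2 X Y) n)) i j ≡⟨ cong₂ _+_ (shiftˣ-cong i) (shiftʸ-cong j) ⟩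
  shiftˣ (binomial n) i j + shiftʸ (binomial n) i j                             ≡⟨ binomial-pascal n i j ⟨
  binomial (suc n) i j                                                          ∎
  where
  open ≡-Reasoning
  shiftˣ-cong : ∀ i → shiftˣ (coeff (powP (add2 X Y) n)) i j ≡ shiftˣ (binomial n) i j
  shiftˣ-cong zero    = refl
  shiftˣ-cong (suc i) = coeff-powP-X+Y n i j
  shiftʸ-cong : ∀ j → shiftʸ (coeff (powP (add2 X Y) n)) i j ≡ shiftʸ (binomial n) i j
  shiftʸ-cong zero    = refl
  shiftʸ-cong (suc j) = coeff-powP-X+Y n i j

binomial-on : ∀ {n i j} → i ℕ.+ j ≡ n → binomial n i j ≡ + (n C i)
binomial-on {n} {i} {j} i+j≡n with i ℕ.+ j ℕ.≡ᵇ n in eq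
... | true  = refl
... | false = ⊥-elim (subst T eq (ℕ.≡⇒≡ᵇ _ _ i+j≡n))

binomial-off : ∀ {n i j} → i ℕ.+ j ≢ n → binomial n i j ≡ 0ℤ
binomial-off {n} {i} {j} i+j≢n with i ℕ.+ j ℕ.≡ᵇ n in eq
... | true  = ⊥-elim (i+j≢n (ℕ.≡ᵇ⇒≡ _ _ (subst T (sym eq) _)))
... | false = refl

binomial-> : ∀ {n i} j → n < i → binomial n i j ≡ 0ℤ
binomial-> {n} {i} j n<i with i ℕ.+ j ℕ.≡ᵇ n
... | true  = cong +_ (k>n⇒nCk≡0 n<i)
... | false = refl

binomialTerm : ℕ → ℕ → Poly
binomialTerm m k = mono (+ (m C k)) k (m ∸ k)

binomial-diag : ∀ m i → binomial m i (m ∸ i) ≡ + (m C i)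
binomial-diag m i with ℕ.≤-<-connex i m
... | inj₁ i≤m = binomial-on {m} {i} (ℕ.m+[n∸m]≡n i≤m)
... | inj₂ m<i = trans (binomial-> (m ∸ i) m<i) (cong +_ (sym (k>n⇒nCk≡0 m<i)))

coeff-binomialTerm : ∀ m i j → coeff (binomialTerm m i) i j ≡ binomial m i j
coeff-binomialTerm m i j with m ∸ i ℕ.≟ j
... | yes refl = trans (coeff-mono _ i (m ∸ i)) (sym (binomial-diag m i))
... | no  m∸i≢j = trans (coeff-mono-≢ʸ _ i (m ∸ i) i j m∸i≢j) (sym (binomial-off {m} {i} i+j≢m))
  where
  i+j≢m : i ℕ.+ j ≢ m
  i+j≢m i+j≡m = m∸i≢j (trans (cong (_∸ i) (sym i+j≡m)) (ℕ.m+n∸m≡n i j))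

row₀-powP-X+Y : ∀ m → row (powP (add2 X Y) m) 0 ≐₁ yMono (+ 1) m
row₀-powP-X+Y m j = begin
  coeff1 (row (powP (add2 X Y) m) 0) j  ≡⟨ coeff-row (powP (add2 X Y) m) 0 j ⟨
  coeff (powP (add2 X Y) m) 0 j         ≡⟨ coeff-powP-X+Y m 0 j ⟩
  binomial m 0 j                        ≡⟨ coeff-binomialTerm m 0 j ⟨
  coeff1 (yMono (+ 1) m) j              ∎
  where open ≡-Reasoning

-- The derivation ψ

module _ {t : ℕ → Poly} (t-row : ∀ k i j → k ≢ i → coeff (t k) i j ≡ 0ℤ) where

  coeff-sumP-outside : ∀ n {a f} → f ≗ (a ℕ.+_) → ∀ i j → i < a ⊎ a ℕ.+ n ≤ i →
                       coeff (sumP (applyUpTo f n) t) i j ≡ 0ℤ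
  coeff-sumP-outside zero            f≗ i j _   = refl
  coeff-sumP-outside (suc n) {a} {f} f≗ i j out =
    trans (coeff-add2 (t (f 0)) (sumP (applyUpTo (f ∘ suc) n) t) i j)
          (cong₂ _+_ (t-row (f 0) i j (f0≢i out)) (coeff-sumP-outside n (λ k → trans (f≗ (suc k)) (ℕ.+-suc a k)) i j (out′ out)))
    where
    f0≢i : i < a ⊎ a ℕ.+ suc n ≤ i → f 0 ≢ i
    f0≢i (inj₁ i<a)   f0≡i = ℕ.<-irrefl (trans (sym f0≡i) (trans (f≗ 0) (ℕ.+-identityʳ a))) i<a
    f0≢i (inj₂ a+n<i) f0≡i = ℕ.<-irrefl (trans (trans (sym (ℕ.+-identityʳ a)) (sym (f≗ 0))) f0≡i)
                                        (ℕ.<-≤-trans (ℕ.m<m+n a (s≤s z≤n)) a+n<i)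
    out′ : i < a ⊎ a ℕ.+ suc n ≤ i → i < suc a ⊎ suc a ℕ.+ n ≤ i
    out′ (inj₁ i<a)   = inj₁ (ℕ.m<n⇒m<1+n i<a)
    out′ (inj₂ a+n<i) = inj₂ (subst (_≤ i) (ℕ.+-suc a n) a+n<i)

  coeff-sumP-inside : ∀ n {a f} → f ≗ (a ℕ.+_) → ∀ i j → a ≤ i → i < a ℕ.+ n →
                      coeff (sumP (applyUpTo f n) t) i j ≡ coeff (t i) i j
  coeff-sumP-inside zero {a} f≗ i j a≤i i<a+0 =
    ⊥-elim (ℕ.<-irrefl refl (ℕ.<-≤-trans i<a+0 (subst (_≤ i) (sym (ℕ.+-identityʳ a)) a≤i)))
  coeff-sumP-inside (suc n) {a} {f} f≗ i j a≤i i<a+n =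
    trans (coeff-add2 (t (f 0)) (sumP (applyUpTo (f ∘ suc) n) t) i j) (split (ℕ.m≤n⇒m<n∨m≡n a≤i))
    where
    f0≡a : f 0 ≡ a
    f0≡a = trans (f≗ 0) (ℕ.+-identityʳ a)
    f∘suc≗ : f ∘ suc ≗ (suc a ℕ.+_)
    f∘suc≗ k = trans (f≗ (suc k)) (ℕ.+-suc a k)
    split : a < i ⊎ a ≡ i → coeff (t (f 0)) i j + coeff (sumP (applyUpTo (f ∘ suc) n) t) i j ≡ coeff (t i) i j
    split (inj₁ a<i)  = trans (cong₂ _+_ (t-row (f 0) i j (λ f0≡i → ℕ.<-irrefl (trans (sym f0≡a) f0≡i) a<i))
                                         (coeff-sumP-inside n f∘suc≗ i j a<i (subst (i <_) (ℕ.+-suc a n) i<a+n)))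
                             (ℤ.+-identityˡ _)
    split (inj₂ refl) = trans (cong₂ _+_ (cong (λ k → coeff (t k) i j) f0≡a)
                                         (coeff-sumP-outside n f∘suc≗ i j (inj₁ ℕ.≤-refl)))
                             (ℤ.+-identityʳ _)

ψˣ ψʸ : ℕ → ℕ → Poly
ψˣ m a = sumP (map (a ℕ.+_) (upTo (suc m ∸ a))) (binomialTerm m)
ψʸ m a = sumP (upTo a) (binomialTerm m)

private
  binomialTerm-row : ∀ m k i j → k ≢ i → coeff (binomialTerm m k) i j ≡ 0ℤ
  binomialTerm-row m k = coeff-mono-≢ˣ _ k (m ∸ k)

  ψˣ-applyUpTo : ∀ m a → ψˣ m a ≡ sumP (applyUpTo (a ℕ.+_) (suc m ∸ a)) (binomialTerm m)
  ψˣ-applyUpTo m a = cong (λ js → sumP js (binomialTerm m)) (map-upTo (a ℕ.+_) (suc m ∸ a))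

coeff-ψˣ-< : ∀ m a i j → i < a → coeff (ψˣ m a) i j ≡ 0ℤ
coeff-ψˣ-< m a i j i<a rewrite ψˣ-applyUpTo m a =
  coeff-sumP-outside (binomialTerm-row m) (suc m ∸ a) (λ _ → refl) i j (inj₁ i<a)

coeff-ψˣ-≥ : ∀ m a i j → a ≤ i → coeff (ψˣ m a) i j ≡ binomial m i j
coeff-ψˣ-≥ m a i j a≤i rewrite ψˣ-applyUpTo m a with ℕ.<-≤-connex i (a ℕ.+ (suc m ∸ a))
... | inj₁ i<end = trans (coeff-sumP-inside (binomialTerm-row m) (suc m ∸ a) (λ _ → refl) i j a≤i i<end)
                         (coeff-binomialTerm m i j)
... | inj₂ end≤i = trans (coeff-sumP-outside (binomialTerm-row m) (suc m ∸ a) (λ _ → refl) i j (inj₂ end≤i))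
                         (sym (binomial-> j (ℕ.≤-trans (ℕ.m≤n+m∸n (suc m) a) end≤i)))

coeff-ψʸ-< : ∀ m a i j → i < a → coeff (ψʸ m a) i j ≡ binomial m i j
coeff-ψʸ-< m a i j i<a =
  trans (coeff-sumP-inside (binomialTerm-row m) a (λ _ → refl) i j z≤n i<a) (coeff-binomialTerm m i j)

coeff-ψʸ-≥ : ∀ m a i j → a ≤ i → coeff (ψʸ m a) i j ≡ 0ℤ
coeff-ψʸ-≥ m a i j a≤i = coeff-sumP-outside (binomialTerm-row m) a (λ _ → refl) i j (inj₂ a≤i)

ψˣ+ψʸ≐powP : ∀ m a → add2 (ψˣ m a) (ψʸ m a) ≐ powP (add2 X Y) m
ψˣ+ψʸ≐powP m a i j with ℕ.<-≤-connex i a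
... | inj₁ i<a = begin
  coeff (add2 (ψˣ m a) (ψʸ m a)) i j       ≡⟨ coeff-add2 (ψˣ m a) (ψʸ m a) i j ⟩
  coeff (ψˣ m a) i j + coeff (ψʸ m a) i j  ≡⟨ cong₂ _+_ (coeff-ψˣ-< m a i j i<a) (coeff-ψʸ-< m a i j i<a) ⟩
  0ℤ + binomial m i j                      ≡⟨ ℤ.+-identityˡ _ ⟩
  binomial m i j                           ≡⟨ coeff-powP-X+Y m i j ⟨
  coeff (powP (add2 X Y) m) i j            ∎
  where open ≡-Reasoning
... | inj₂ a≤i = begin
  coeff (add2 (ψˣ m a) (ψʸ m a)) i j       ≡⟨ coeff-add2 (ψˣ m a) (ψʸ m a) i j ⟩
  coeff (ψˣ m a) i j + coeff (ψʸ m a) i j  ≡⟨ cong₂ _+_ (coeff-ψˣ-≥ m a i j a≤i) (coeff-ψʸ-≥ m a i j a≤i) ⟩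
  binomial m i j + 0ℤ                      ≡⟨ ℤ.+-identityʳ _ ⟩
  binomial m i j                           ≡⟨ coeff-powP-X+Y m i j ⟨
  coeff (powP (add2 X Y) m) i j            ∎
  where open ≡-Reasoning

-- Coefficients modulo p

module Modulo (p : ℕ) where

  infix 4 _≋_

  -- A record so that x and y are inferable; its field is the relation used coefficientwise by _≈[_]_.
  record _≋_ (x y : ℤ) : Set where
    constructor mod
    field unmod : + p ℤD.∣ (x - y)

  private
    signed : ∀ {x y} → x ≋ y → + p S.∣ (x - y)
    signed {x} {y} (mod x-y) = S.∣ᵤ⇒∣ {+ p} {x - y} x-y

    via : ∀ {z x y} → z ≡ x - y → + p S.∣ z → x ≋ y
    via {z} refl p∣z = mod (S.∣⇒∣ᵤ {+ p} {z} p∣z)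

  ≋-reflexive : ∀ {x y} → x ≡ y → x ≋ y
  ≋-reflexive {x} refl = mod (subst (+ p ℤD.∣_) (sym (ℤ.+-inverseʳ x)) (p ℕD.∣0))

  ≋-sym : ∀ {x y} → x ≋ y → y ≋ x
  ≋-sym {x} {y} x≋y = via (identity x y) (S.∣m⇒∣-m (signed x≋y))
    where
    identity : ∀ x y → - (x - y) ≡ y - x
    identity = solve-∀

  ≋-trans : ∀ {x y z} → x ≋ y → y ≋ z → x ≋ z
  ≋-trans {x} {y} {z} x≋y y≋z = via (identity x y z) (S.∣m∣n⇒∣m+n (signed x≋y) (signed y≋z))
    where
    identity : ∀ x y z → (x - y) + (y - z) ≡ x - z
    identity = solve-∀

  ≋-respˡ : ∀ {x y z} → x ≡ y → y ≋ z → x ≋ z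
  ≋-respˡ refl y≋z = y≋z

  ≋-setoid : Setoid 0ℓ 0ℓ
  ≋-setoid = record
    { Carrier       = ℤ
    ; _≈_           = _≋_
    ; isEquivalence = record { refl = ≋-reflexive refl ; sym = ≋-sym ; trans = ≋-trans }
    }

  module ≋-Reasoning = SetoidReasoning ≋-setoid

  +-cong-≋ : ∀ {x y u v} → x ≋ y → u ≋ v → x + u ≋ y + v
  +-cong-≋ {x} {y} {u} {v} x≋y u≋v = via (identity x y u v) (S.∣m∣n⇒∣m+n (signed x≋y) (signed u≋v))
    where
    identity : ∀ x y u v → (x - y) + (u - v) ≡ (x + u) - (y + v)
    identity = solve-∀

  +-congˡ-≋ : ∀ x {u v} → u ≋ v → x + u ≋ x + v
  +-congˡ-≋ x = +-cong-≋ (≋-reflexive {x} refl)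

  +-congʳ-≋ : ∀ x {u v} → u ≋ v → u + x ≋ v + x
  +-congʳ-≋ x u≋v = +-cong-≋ u≋v (≋-reflexive {x} refl)

  *-congˡ-≋ : ∀ c {x y} → x ≋ y → c * x ≋ c * y
  *-congˡ-≋ c {x} {y} x≋y = via (identity c x y) (S.∣n⇒∣m*n c (signed x≋y))
    where
    identity : ∀ c x y → c * (x - y) ≡ c * x - c * y
    identity = solve-∀

  -‿cong-≋ : ∀ {x y} → x ≋ y → - x ≋ - y
  -‿cong-≋ {x} {y} x≋y = via (identity x y) (S.∣m⇒∣-m (signed x≋y))
    where
    identity : ∀ x y → - (x - y) ≡ - x - - y
    identity = solve-∀

  *-≋0 : ∀ c {x} → x ≋ 0ℤ → c * x ≋ 0ℤ
  *-≋0 c x≋0 = ≋-trans (*-congˡ-≋ c x≋0) (≋-reflexive (ℤ.*-zeroʳ c))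

  x≋y⇒x-y≋0 : ∀ {x y} → x ≋ y → x - y ≋ 0ℤ
  x≋y⇒x-y≋0 {x} {y} x≋y = ≋-trans (+-congʳ-≋ (- y) x≋y) (≋-reflexive (ℤ.+-inverseʳ y))

  ≋0-cancelˡ : ∀ {x y} → x + y ≋ 0ℤ → x ≋ 0ℤ → y ≋ 0ℤ
  ≋0-cancelˡ {x} {y} x+y≋0 x≋0 = ≋-respˡ (identity x y) (+-cong-≋ x+y≋0 (-‿cong-≋ x≋0))
    where
    identity : ∀ x y → y ≡ (x + y) + - x
    identity = solve-∀

  +n≋0⇔∣ : ∀ n → + n ≋ 0ℤ ⇔ p ℕD.∣ n
  +n≋0⇔∣ n = mk⇔ (subst (p ℕD.∣_) (ℕ.+-identityʳ n) ∘ _≋_.unmod) (mod ∘ subst (p ℕD.∣_) (sym (ℕ.+-identityʳ n)))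

  ≈⇒≋ : ∀ f g → f ≈[ p ] g → ∀ i j → coeff f i j ≋ coeff g i j
  ≈⇒≋ f g f≈g i j = mod (f≈g i j)

  mul1-vanishesʳ : ∀ r s j → (∀ k → k ≤ j → coeff1 s k ≋ 0ℤ) → coeff1 (mul1 r s) j ≋ 0ℤ
  mul1-vanishesʳ []      s j s≋0 = ≋-reflexive refl
  mul1-vanishesʳ (c ∷ r) s j s≋0 =
    ≋-respˡ (coeff1-mul1-∷ˡ c r s j) (+-cong-≋ (*-≋0 c (s≋0 j ℕ.≤-refl)) (shifted j s≋0))
    where
    shifted : ∀ j → (∀ k → k ≤ j → coeff1 s k ≋ 0ℤ) → coeff1 (0ℤ ∷ mul1 r s) j ≋ 0ℤ
    shifted zero    _   = ≋-reflexive refl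
    shifted (suc j) s≋0 = mul1-vanishesʳ r s j (λ k k≤j → s≋0 k (ℕ.m≤n⇒m≤1+n k≤j))

  mul2-vanishesʳ : ∀ f g i j → (∀ i′ j′ → i′ ≤ i → j′ ≤ j → coeff g i′ j′ ≋ 0ℤ) → coeff (mul2 f g) i j ≋ 0ℤ
  mul2-vanishesʳ []      g i j g≋0 = ≋-reflexive refl
  mul2-vanishesʳ (r ∷ f) g i j g≋0 =
    ≋-respˡ (coeff-mul2-∷ˡ r f g i j)
            (+-cong-≋ (mul1-vanishesʳ r (row g i) j (λ k k≤j → ≋-respˡ (sym (coeff-row g i k)) (g≋0 i k ℕ.≤-refl k≤j)))
                  (shifted i g≋0))
    where
    shifted : ∀ i → (∀ i′ j′ → i′ ≤ i → j′ ≤ j → coeff g i′ j′ ≋ 0ℤ) → coeff ([] ∷ mul2 f g) i j ≋ 0ℤ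
    shifted zero    _   = ≋-reflexive refl
    shifted (suc i) g≋0 = mul2-vanishesʳ f g i j (λ i′ j′ i′≤i → g≋0 i′ j′ (ℕ.m≤n⇒m≤1+n i′≤i))

  Divides-respˡ : ∀ {d d′ f} → d ≐ d′ → Divides p d f → Divides p d′ f
  Divides-respˡ {d} {d′} {f} d≐d′ (q , f≈dq) =
    q , λ i j → _≋_.unmod (≋-trans (≈⇒≋ f (mul2 d q) f≈dq i j) (≋-reflexive (mul2-congˡ {d} {d′} q d≐d′ i j)))

  divides-mono⇔ : ∀ a b f → Divides p (mono (+ 1) a b) f ⇔ (∀ i j → i < a ⊎ j < b → coeff f i j ≋ 0ℤ)
  divides-mono⇔ a b f = mk⇔ vanishes quotient
    where
    vanishes : Divides p (mono (+ 1) a b) f → ∀ i j → i < a ⊎ j < b → coeff f i j ≋ 0ℤ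
    vanishes (q , f≈Mq) i j out =
      ≋-trans (≈⇒≋ f (mul2 (mono (+ 1) a b) q) f≈Mq i j) (≋-reflexive (coeff-mono-mul2-outside (+ 1) a b q i j out))
    quotient : (∀ i j → i < a ⊎ j < b → coeff f i j ≋ 0ℤ) → Divides p (mono (+ 1) a b) f
    quotient f≋0 = monoQuotient a b f , λ i j → _≋_.unmod (agree i j)
      where
      agree : ∀ i j → coeff f i j ≋ coeff (mul2 (mono (+ 1) a b) (monoQuotient a b f)) i j
      agree i j with position a b i j
      ... | outside out = ≋-trans (f≋0 i j out) (≋-reflexive (sym (coeff-mono-mul2-outside (+ 1) a b _ i j out)))
      ... | inside k l  = ≋-reflexive (sym (begin
        coeff (mul2 (mono (+ 1) a b) (monoQuotient a b f)) (a ℕ.+ k) (b ℕ.+ l) ≡⟨ coeff-mono-mul2-+ (+ 1) a b _ k l ⟩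
        + 1 * coeff (monoQuotient a b f) k l                                  ≡⟨ ℤ.*-identityˡ _ ⟩
        coeff (monoQuotient a b f) k l                                        ≡⟨ coeff-monoQuotient a b f k l ⟩
        coeff f (a ℕ.+ k) (b ℕ.+ l)                                           ∎))
        where open ≡-Reasoning

  divides-powP-X⇔ : ∀ n f → Divides p (powP X n) f ⇔ (∀ i j → i < n → coeff f i j ≋ 0ℤ)
  divides-powP-X⇔ n f = mk⇔
    (λ x^n∣f i j i<n → Equivalence.to (divides-mono⇔ n 0 f)
                          (Divides-respˡ {powP X n} {mono (+ 1) n 0} {f} (powP-X n) x^n∣f) i j (inj₁ i<n))
    (λ f≋0 → Divides-respˡ {mono (+ 1) n 0} {powP X n} {f} (λ i j → sym (powP-X n i j))
                           (Equivalence.from (divides-mono⇔ n 0 f) λ { i j (inj₁ i<n) → f≋0 i j i<n }))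

  divides-powP-Y⇔ : ∀ n f → Divides p (powP Y n) f ⇔ (∀ i j → j < n → coeff f i j ≋ 0ℤ)
  divides-powP-Y⇔ n f = mk⇔
    (λ y^n∣f i j j<n → Equivalence.to (divides-mono⇔ 0 n f)
                          (Divides-respˡ {powP Y n} {mono (+ 1) 0 n} {f} (powP-Y n) y^n∣f) i j (inj₂ j<n))
    (λ f≋0 → Divides-respˡ {mono (+ 1) 0 n} {powP Y n} {f} (λ i j → sym (powP-Y n i j))
                           (Equivalence.from (divides-mono⇔ 0 n f) λ { i j (inj₂ j<n) → f≋0 i j j<n }))

  -- Row 0 of (x + y)^m is y^m, so row 0 of f (x + y)^m is y^m times row 0 of f; peel it off and recurse.
  mul2-powP-X+Y-cancel : ∀ m f → (∀ i j → coeff (mul2 f (powP (add2 X Y) m)) i j ≋ 0ℤ) → ∀ i j → coeff f i j ≋ 0ℤ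
  mul2-powP-X+Y-cancel m []      _    i j = ≋-reflexive refl
  mul2-powP-X+Y-cancel m (r ∷ f) fP≋0 = vanishes
    where
    P : Poly
    P = powP (add2 X Y) m

    r≋0 : ∀ j → coeff1 r j ≋ 0ℤ
    r≋0 j = ≋-respˡ (sym lowest-row) (fP≋0 0 (m ℕ.+ j))
      where
      open ≡-Reasoning
      lowest-row : coeff (mul2 (r ∷ f) P) 0 (m ℕ.+ j) ≡ coeff1 r j
      lowest-row = begin
        coeff (mul2 (r ∷ f) P) 0 (m ℕ.+ j)            ≡⟨ coeff-mul2-∷ˡ r f P 0 (m ℕ.+ j) ⟩
        coeff1 (mul1 r (row P 0)) (m ℕ.+ j) + 0ℤ      ≡⟨ ℤ.+-identityʳ _ ⟩
        coeff1 (mul1 r (row P 0)) (m ℕ.+ j)           ≡⟨ mul1-congʳ r (row₀-powP-X+Y m) (m ℕ.+ j) ⟩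
        coeff1 (mul1 r (yMono (+ 1) m)) (m ℕ.+ j)     ≡⟨ mul1-comm r (yMono (+ 1) m) (m ℕ.+ j) ⟩
        coeff1 (mul1 (yMono (+ 1) m) r) (m ℕ.+ j)     ≡⟨ coeff1-mul1-yMono-+ (+ 1) m r j ⟩
        + 1 * coeff1 r j                              ≡⟨ ℤ.*-identityˡ _ ⟩
        coeff1 r j                                    ∎

    f·P≋0 : ∀ i j → coeff (mul2 f P) i j ≋ 0ℤ
    f·P≋0 i j = ≋0-cancelˡ (≋-respˡ (sym (coeff-mul2-∷ˡ r f P (suc i) j)) (fP≋0 (suc i) j))
                           (≋-respˡ (mul1-comm r (row P (suc i)) j) (mul1-vanishesʳ (row P (suc i)) r j (λ k _ → r≋0 k)))

    vanishes : ∀ i j → coeff (r ∷ f) i j ≋ 0ℤ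
    vanishes zero    j = r≋0 j
    vanishes (suc i) j = mul2-powP-X+Y-cancel m f f·P≋0 i j

  -- The basis {ψ_μ, ψ'_μ}

  -- m < b + k is m ∸ k < b without truncated subtraction: the term C(m,k) x^k y^(m-k) of ψʸ lies below y^b.
  LowTermsVanish : ℕ → ℕ → ℕ → Set
  LowTermsVanish m a b = ∀ k → k < a → m < b ℕ.+ k → p ℕD.∣ m C k

  ψʸ-vanishes⇔ : ∀ m a b → (∀ i j → j < b → coeff (ψʸ m a) i j ≋ 0ℤ) ⇔ LowTermsVanish m a b
  ψʸ-vanishes⇔ m a b = mk⇔ necessary sufficient
    where
    necessary : (∀ i j → j < b → coeff (ψʸ m a) i j ≋ 0ℤ) → LowTermsVanish m a b
    necessary ψʸ≋0 k k<a m<b+k with ℕ.≤-<-connex k m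
    ... | inj₂ m<k = subst (p ℕD.∣_) (sym (k>n⇒nCk≡0 m<k)) (p ℕD.∣0)
    ... | inj₁ k≤m = Equivalence.to (+n≋0⇔∣ (m C k))
                       (≋-respˡ (sym (trans (coeff-ψʸ-< m a k (m ∸ k) k<a) (binomial-diag m k))) (ψʸ≋0 k (m ∸ k) m∸k<b))
      where
      m∸k<b : m ∸ k < b
      m∸k<b = ℕ.+-cancelʳ-< k (m ∸ k) b (subst (_< b ℕ.+ k) (sym (ℕ.m∸n+n≡m k≤m)) m<b+k)
    sufficient : LowTermsVanish m a b → ∀ i j → j < b → coeff (ψʸ m a) i j ≋ 0ℤ
    sufficient low i j j<b with ℕ.<-≤-connex i a
    ... | inj₂ a≤i = ≋-reflexive (coeff-ψʸ-≥ m a i j a≤i)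
    ... | inj₁ i<a = ≋-respˡ (coeff-ψʸ-< m a i j i<a) binomial≋0
      where
      binomial≋0 : binomial m i j ≋ 0ℤ
      binomial≋0 with i ℕ.+ j ℕ.≟ m
      ... | no  i+j≢m = ≋-reflexive (binomial-off {m} {i} i+j≢m)
      ... | yes i+j≡m = ≋-respˡ (binomial-on {m} {i} i+j≡m) (Equivalence.from (+n≋0⇔∣ (m C i)) (low i i<a m<b+i))
        where
        m<b+i : m < b ℕ.+ i
        m<b+i = subst (_< b ℕ.+ i) i+j≡m (subst (i ℕ.+ j <_) (ℕ.+-comm i b) (ℕ.+-monoʳ-< i j<b))

  ψ∈D : ∀ m a b → LowTermsVanish m a b → InD p (a , b , m) (ψ m (a , b , m))
  ψ∈D m a b low =
      Equivalence.from (divides-powP-X⇔ a (ψˣ m a)) (λ i j i<a → ≋-reflexive (coeff-ψˣ-< m a i j i<a))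
    , Equivalence.from (divides-powP-Y⇔ b (ψʸ m a)) (Equivalence.from (ψʸ-vanishes⇔ m a b) low)
    , mono (+ 1) 0 0
    , λ i j → _≋_.unmod (≋-reflexive (trans (ψˣ+ψʸ≐powP m a i j) (sym (mul2-identityʳ (powP (add2 X Y) m) i j))))

  ψ′∈D : ∀ m a b → InD p (a , b , m) (ψ' (a , b , m))
  ψ′∈D m a b =
      Equivalence.from (divides-powP-X⇔ a (neg2 M))
        (λ i j i<a → ≋-reflexive (trans (coeff-neg2 M i j) (cong -_ (coeff-mono-≢ˣ (+ 1) a b i j (ℕ.>⇒≢ i<a)))))
    , Equivalence.from (divides-powP-Y⇔ b M) (λ i j j<b → ≋-reflexive (coeff-mono-≢ʸ (+ 1) a b i j (ℕ.>⇒≢ j<b)))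
    , [] , λ i j → _≋_.unmod (≋-reflexive (begin
        coeff (add2 (neg2 M) M) i j              ≡⟨ coeff-add2 (neg2 M) M i j ⟩
        coeff (neg2 M) i j + coeff M i j         ≡⟨ cong (_+ coeff M i j) (coeff-neg2 M i j) ⟩
        - coeff M i j + coeff M i j              ≡⟨ ℤ.+-inverseˡ (coeff M i j) ⟩
        0ℤ                                       ≡⟨ mul2-zeroʳ (powP (add2 X Y) m) i j ⟨
        coeff (mul2 (powP (add2 X Y) m) []) i j  ∎))
    where
    open ≡-Reasoning
    M : Poly
    M = mono (+ 1) a b

  ψ-spans : ∀ m a b → LowTermsVanish m a b → ∀ θ → InD p (a , b , m) θ →
            Σ Poly λ A → Σ Poly λ B → θ ≈D[ p ] lin A (ψ m (a , b , m)) B (ψ' (a , b , m))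
  ψ-spans m a b low (f , g) (x^a∣f , y^b∣g , q , f+g≈Pq) =
    q , monoQuotient a b h , (λ i j → _≋_.unmod (f≋ i j)) , (λ i j → _≋_.unmod (g≋ i j))
    where
    P M h B : Poly
    P = powP (add2 X Y) m
    M = mono (+ 1) a b
    h = add2 g (neg2 (mul2 q (ψʸ m a)))
    B = monoQuotient a b h

    F G QX QY BM : ℕ → ℕ → ℤ
    F  = coeff f
    G  = coeff g
    QX = coeff (mul2 q (ψˣ m a))
    QY = coeff (mul2 q (ψʸ m a))
    BM = coeff (mul2 B M)

    F+G≋QX+QY : ∀ i j → F i j + G i j ≋ QX i j + QY i j
    F+G≋QX+QY i j = begin
      F i j + G i j                                     ≡⟨ coeff-add2 f g i j ⟨
      coeff (add2 f g) i j                              ≈⟨ ≈⇒≋ (add2 f g) (mul2 P q) f+g≈Pq i j ⟩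
      coeff (mul2 P q) i j                              ≡⟨ mul2-comm P q i j ⟩
      coeff (mul2 q P) i j                              ≡⟨ mul2-congʳ q (λ i j → sym (ψˣ+ψʸ≐powP m a i j)) i j ⟩
      coeff (mul2 q (add2 (ψˣ m a) (ψʸ m a))) i j       ≡⟨ mul2-distribˡ q (ψˣ m a) (ψʸ m a) i j ⟩
      coeff (add2 (mul2 q (ψˣ m a)) (mul2 q (ψʸ m a))) i j ≡⟨ coeff-add2 (mul2 q (ψˣ m a)) (mul2 q (ψʸ m a)) i j ⟩
      QX i j + QY i j                                   ∎
      where open ≋-Reasoning

    F≋0 : ∀ i j → i < a → F i j ≋ 0ℤ
    F≋0 = Equivalence.to (divides-powP-X⇔ a f) x^a∣f
    G≋0 : ∀ i j → j < b → G i j ≋ 0ℤ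
    G≋0 = Equivalence.to (divides-powP-Y⇔ b g) y^b∣g
    QX≋0 : ∀ i j → i < a → QX i j ≋ 0ℤ
    QX≋0 i j i<a = mul2-vanishesʳ q (ψˣ m a) i j
      (λ i′ j′ i′≤i _ → ≋-reflexive (coeff-ψˣ-< m a i′ j′ (ℕ.≤-<-trans i′≤i i<a)))
    QY≋0 : ∀ i j → j < b → QY i j ≋ 0ℤ
    QY≋0 i j j<b = mul2-vanishesʳ q (ψʸ m a) i j
      (λ i′ j′ _ j′≤j → Equivalence.from (ψʸ-vanishes⇔ m a b) low i′ j′ (ℕ.≤-<-trans j′≤j j<b))

    coeff-h : ∀ i j → coeff h i j ≡ G i j - QY i j
    coeff-h i j = trans (coeff-add2 g (neg2 (mul2 q (ψʸ m a))) i j) (cong (_+_ (G i j)) (coeff-neg2 (mul2 q (ψʸ m a)) i j))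

    h-vanishes : ∀ i j → i < a ⊎ j < b → coeff h i j ≋ 0ℤ
    h-vanishes i j (inj₂ j<b) = ≋-respˡ (coeff-h i j) (+-cong-≋ (G≋0 i j j<b) (-‿cong-≋ (QY≋0 i j j<b)))
    h-vanishes i j (inj₁ i<a) =
      ≋-respˡ (trans (coeff-h i j) (identity (F i j) (G i j) (QX i j) (QY i j)))
              (+-cong-≋ (x≋y⇒x-y≋0 (F+G≋QX+QY i j)) (+-cong-≋ (QX≋0 i j i<a) (-‿cong-≋ (F≋0 i j i<a))))
      where
      identity : ∀ F G QX QY → G - QY ≡ ((F + G) - (QX + QY)) + (QX + - F)
      identity = solve-∀

    G-QY≋BM : ∀ i j → G i j - QY i j ≋ BM i j
    G-QY≋BM i j = begin
      G i j - QY i j        ≡⟨ coeff-h i j ⟨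
      coeff h i j           ≈⟨ ≈⇒≋ h (mul2 M B) (proj₂ (Equivalence.from (divides-mono⇔ a b h) h-vanishes)) i j ⟩
      coeff (mul2 M B) i j  ≡⟨ mul2-comm M B i j ⟩
      BM i j                ∎
      where open ≋-Reasoning

    g≋ : ∀ i j → G i j ≋ coeff (add2 (mul2 q (ψʸ m a)) (mul2 B M)) i j
    g≋ i j = begin
      G i j                     ≡⟨ identity (G i j) (QY i j) ⟩
      QY i j + (G i j - QY i j) ≈⟨ +-congˡ-≋ (QY i j) (G-QY≋BM i j) ⟩
      QY i j + BM i j           ≡⟨ coeff-add2 (mul2 q (ψʸ m a)) (mul2 B M) i j ⟨
      coeff (add2 (mul2 q (ψʸ m a)) (mul2 B M)) i j ∎
      where
      open ≋-Reasoning
      identity : ∀ G QY → G ≡ QY + (G - QY)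
      identity = solve-∀

    f≋ : ∀ i j → F i j ≋ coeff (add2 (mul2 q (ψˣ m a)) (mul2 B (neg2 M))) i j
    f≋ i j = begin
      F i j                                              ≡⟨ identity₁ (F i j) (G i j) (QY i j) ⟩
      (F i j + G i j) - (G i j - QY i j) - QY i j
        ≈⟨ +-congʳ-≋ (- QY i j) (+-cong-≋ (F+G≋QX+QY i j) (-‿cong-≋ (G-QY≋BM i j))) ⟩
      (QX i j + QY i j) - BM i j - QY i j                ≡⟨ identity₂ (QX i j) (QY i j) (BM i j) ⟩
      QX i j + - BM i j                                  ≡⟨ cong (_+_ (QX i j)) (coeff-mul2-neg2-mono B a b i j) ⟨
      QX i j + coeff (mul2 B (neg2 M)) i j               ≡⟨ coeff-add2 (mul2 q (ψˣ m a)) (mul2 B (neg2 M)) i j ⟨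
      coeff (add2 (mul2 q (ψˣ m a)) (mul2 B (neg2 M))) i j ∎
      where
      open ≋-Reasoning
      identity₁ : ∀ F G QY → F ≡ (F + G) - (G - QY) - QY
      identity₁ = solve-∀
      identity₂ : ∀ QX QY BM → (QX + QY) - BM - QY ≡ QX + - BM
      identity₂ = solve-∀

  ψ-independent : ∀ m a b A B → lin A (ψ m (a , b , m)) B (ψ' (a , b , m)) ≈D[ p ] zeroD →
                  (A ≈[ p ] zeroP) × (B ≈[ p ] zeroP)
  ψ-independent m a b A B (Aψˣ-BM≈0 , Aψʸ+BM≈0) = (λ i j → _≋_.unmod (A≋0 i j)) , (λ i j → _≋_.unmod (B≋0 i j))
    where
    M : Poly
    M = mono (+ 1) a b
    AX AY BM : ℕ → ℕ → ℤ
    AX = coeff (mul2 A (ψˣ m a))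
    AY = coeff (mul2 A (ψʸ m a))
    BM = coeff (mul2 B M)

    AX-BM≋0 : ∀ i j → AX i j + - BM i j ≋ 0ℤ
    AX-BM≋0 i j = ≋-respˡ (sym (trans (coeff-add2 (mul2 A (ψˣ m a)) (mul2 B (neg2 M)) i j)
                                      (cong (_+_ (AX i j)) (coeff-mul2-neg2-mono B a b i j))))
                          (≈⇒≋ (add2 (mul2 A (ψˣ m a)) (mul2 B (neg2 M))) zeroP Aψˣ-BM≈0 i j)

    AY+BM≋0 : ∀ i j → AY i j + BM i j ≋ 0ℤ
    AY+BM≋0 i j = ≋-respˡ (sym (coeff-add2 (mul2 A (ψʸ m a)) (mul2 B M) i j))
                          (≈⇒≋ (add2 (mul2 A (ψʸ m a)) (mul2 B M)) zeroP Aψʸ+BM≈0 i j)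

    AP≋0 : ∀ i j → coeff (mul2 A (powP (add2 X Y) m)) i j ≋ 0ℤ
    AP≋0 i j = ≋-respˡ AP≡ (+-cong-≋ (AX-BM≋0 i j) (AY+BM≋0 i j))
      where
      open ≡-Reasoning
      identity : ∀ AX AY BM → AX + AY ≡ (AX + - BM) + (AY + BM)
      identity = solve-∀
      AP≡ : coeff (mul2 A (powP (add2 X Y) m)) i j ≡ (AX i j + - BM i j) + (AY i j + BM i j)
      AP≡ = begin
        coeff (mul2 A (powP (add2 X Y) m)) i j             ≡⟨ mul2-congʳ A (λ i j → sym (ψˣ+ψʸ≐powP m a i j)) i j ⟩
        coeff (mul2 A (add2 (ψˣ m a) (ψʸ m a))) i j        ≡⟨ mul2-distribˡ A (ψˣ m a) (ψʸ m a) i j ⟩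
        coeff (add2 (mul2 A (ψˣ m a)) (mul2 A (ψʸ m a))) i j ≡⟨ coeff-add2 (mul2 A (ψˣ m a)) (mul2 A (ψʸ m a)) i j ⟩
        AX i j + AY i j                                    ≡⟨ identity (AX i j) (AY i j) (BM i j) ⟩
        (AX i j + - BM i j) + (AY i j + BM i j)            ∎

    A≋0 : ∀ i j → coeff A i j ≋ 0ℤ
    A≋0 = mul2-powP-X+Y-cancel m A AP≋0

    BM≋0 : ∀ i j → BM i j ≋ 0ℤ
    BM≋0 i j = ≋0-cancelˡ (AY+BM≋0 i j)
                 (≋-respˡ (mul2-comm A (ψʸ m a) i j) (mul2-vanishesʳ (ψʸ m a) A i j (λ i′ j′ _ _ → A≋0 i′ j′)))

    B≋0 : ∀ i j → coeff B i j ≋ 0ℤ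
    B≋0 i j = ≋-respˡ B≡ (BM≋0 (a ℕ.+ i) (b ℕ.+ j))
      where
      B≡ : coeff B i j ≡ BM (a ℕ.+ i) (b ℕ.+ j)
      B≡ = sym (trans (mul2-comm B M (a ℕ.+ i) (b ℕ.+ j)) (trans (coeff-mono-mul2-+ (+ 1) a b B i j) (ℤ.*-identityˡ _)))

  isBasis⇔lowTermsVanish : ∀ m a b → IsBasis p (a , b , m) (ψ m (a , b , m)) (ψ' (a , b , m)) ⇔ LowTermsVanish m a b
  isBasis⇔lowTermsVanish m a b = mk⇔
    (λ { ((_ , y^b∣ψʸ , _) , _) →
           Equivalence.to (ψʸ-vanishes⇔ m a b) (Equivalence.to (divides-powP-Y⇔ b (ψʸ m a)) y^b∣ψʸ) })
    (λ low → ψ∈D m a b low , ψ′∈D m a b , ψ-spans m a b low , ψ-independent m a b)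

  NonvanishingLowTerm : ℕ → ℕ → ℕ → Set
  NonvanishingLowTerm m a b = ∃ λ k → k < a × (m < b ℕ.+ k × ¬ p ℕD.∣ m C k)

  ¬isBasis⇔nonvanishingLowTerm : ∀ m a b → (¬ IsBasis p (a , b , m) (ψ m (a , b , m)) (ψ' (a , b , m))) ⇔ NonvanishingLowTerm m a b
  ¬isBasis⇔nonvanishingLowTerm m a b = mk⇔ witness (λ { (k , k<a , m<b+k , p∤C) basis → p∤C (to basis k k<a m<b+k) })
    where
    open Equivalence (isBasis⇔lowTermsVanish m a b)
    witness : ¬ IsBasis p (a , b , m) (ψ m (a , b , m)) (ψ' (a , b , m)) → NonvanishingLowTerm m a b
    witness ¬basis with ℕ.anyUpTo? (λ k → (m ℕ.<? b ℕ.+ k) ×-dec ¬? (p ℕD.∣? m C k)) a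
    ... | yes term = term
    ... | no ¬term = ⊥-elim (¬basis (from λ k k<a m<b+k →
                       decidable-stable (p ℕD.∣? m C k) (λ p∤C → ¬term (k , k<a , m<b+k , p∤C))))

  nonvanishingLowTerm⇔aboveB : ∀ m a b → NonvanishingLowTerm m a b ⇔ Σ Mult λ β → InB p m β × β ⊆μ (a , b , m)
  nonvanishingLowTerm⇔aboveB m a b = mk⇔ generator lowTerm
    where
    generator : NonvanishingLowTerm m a b → Σ Mult λ β → InB p m β × β ⊆μ (a , b , m)
    generator (k , k<a , m<b+k , p∤C) =
      (suc k , suc m ∸ k , m) , (refl , sum , k , refl , p∤C) , (k<a , m+1∸k≤b , ℕ.≤-refl)
      where
      k≤m : k ≤ m
      k≤m = ℕ.≮⇒≥ (λ m<k → p∤C (subst (p ℕD.∣_) (sym (k>n⇒nCk≡0 m<k)) (p ℕD.∣0)))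
      sum : suc k ℕ.+ (suc m ∸ k) ≡ m ℕ.+ 2
      sum = trans (cong suc (ℕ.m+[n∸m]≡n (ℕ.m≤n⇒m≤1+n k≤m))) (ℕ.+-comm 2 m)
      m+1∸k≤b : suc m ∸ k ≤ b
      m+1∸k≤b = ℕ.m≤n+o⇒m∸n≤o (suc m) k (subst (suc m ≤_) (ℕ.+-comm b k) m<b+k)
    lowTerm : (Σ Mult λ β → InB p m β × β ⊆μ (a , b , m)) → NonvanishingLowTerm m a b
    lowTerm ((.(suc k) , b′ , .m) , (refl , sum , k , refl , p∤C) , (k<a , b′≤b , _)) =
      k , k<a , ℕ.≤-trans (ℕ.≤-reflexive (sym b′+k≡m+1)) (ℕ.+-monoˡ-≤ k b′≤b) , p∤C
      where
      b′+k≡m+1 : b′ ℕ.+ k ≡ suc m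
      b′+k≡m+1 = trans (ℕ.+-comm b′ k) (ℕ.suc-injective (trans sum (ℕ.+-comm m 2)))

  ∉Γ⇔aboveB : ∀ m μ → InΛ∖Γ p m μ ⇔ InU m (InB p m) μ
  ∉Γ⇔aboveB m (a , b , c) = mk⇔
    (λ { (refl , ¬basis) → refl , to (nonvanishingLowTerm⇔aboveB m a b) (to (¬isBasis⇔nonvanishingLowTerm m a b) ¬basis) })
    (λ { (refl , above) → refl , from (¬isBasis⇔nonvanishingLowTerm m a b) (from (nonvanishingLowTerm⇔aboveB m a b) above) })
    where open Equivalence

-- Minimal elements

⊆μ-refl : ∀ μ → μ ⊆μ μ
⊆μ-refl μ = ℕ.≤-refl , ℕ.≤-refl , ℕ.≤-refl

⊆μ-trans : ∀ {μ ν κ} → μ ⊆μ ν → ν ⊆μ κ → μ ⊆μ κ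
⊆μ-trans (a≤ , b≤ , c≤) (a≤′ , b≤′ , c≤′) = ℕ.≤-trans a≤ a≤′ , ℕ.≤-trans b≤ b≤′ , ℕ.≤-trans c≤ c≤′

⊆μ-antisym : ∀ {μ ν} → μ ⊆μ ν → ν ⊆μ μ → μ ≡ ν
⊆μ-antisym (a≤ , b≤ , c≤) (a≥ , b≥ , c≥) =
  cong₂ _,_ (ℕ.≤-antisym a≤ a≥) (cong₂ _,_ (ℕ.≤-antisym b≤ b≥) (ℕ.≤-antisym c≤ c≥))

Antichain : (Mult → Set) → Set
Antichain T = ∀ μ ν → T μ → T ν → μ ⊆μ ν → μ ≡ ν

antichain⇔minimal : ∀ m (T P : Mult → Set) → (∀ μ → T μ → InΛ m μ) → Antichain T →
                    (∀ μ → P μ ⇔ InU m T μ) → ∀ μ → T μ ⇔ Minimal P μ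
antichain⇔minimal m T P T⊆Λ antichain P⇔U μ = mk⇔ minimal generator
  where
  open Equivalence
  T⊆P : ∀ β → T β → P β
  T⊆P β Tβ = from (P⇔U β) (T⊆Λ β Tβ , β , Tβ , ⊆μ-refl β)
  minimal : T μ → Minimal P μ
  minimal Tμ = T⊆P μ Tμ , below
    where
    below : ∀ ν → P ν → ν ⊆μ μ → ν ≡ μ
    below ν Pν ν⊆μ with to (P⇔U ν) Pν
    ... | _ , β , Tβ , β⊆ν with antichain β μ Tβ Tμ (⊆μ-trans β⊆ν ν⊆μ)
    ...   | refl = ⊆μ-antisym ν⊆μ β⊆ν
  generator : Minimal P μ → T μ
  generator (Pμ , below) with to (P⇔U μ) Pμ
  ... | _ , β , Tβ , β⊆μ = subst T (below β (T⊆P β Tβ) β⊆μ) Tβ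

≤-≤-+-≡⇒≡ : ∀ {a a′ b b′} → a ≤ a′ → b ≤ b′ → a ℕ.+ b ≡ a′ ℕ.+ b′ → a ≡ a′ × b ≡ b′
≤-≤-+-≡⇒≡ {a} {a′} {b} {b′} a≤a′ b≤b′ a+b≡a′+b′ =
  a≡a′ , ℕ.+-cancelˡ-≡ a b b′ (trans a+b≡a′+b′ (cong (ℕ._+ b′) (sym a≡a′)))
  where
  a≡a′ : a ≡ a′
  a≡a′ = ℕ.≤-antisym a≤a′
           (ℕ.+-cancelʳ-≤ b a′ a (ℕ.≤-trans (ℕ.+-monoʳ-≤ a′ b≤b′) (ℕ.≤-reflexive (sym a+b≡a′+b′))))

B-antichain : ∀ p m → Antichain (InB p m)
B-antichain p m (a , b , .m) (a′ , b′ , .m) (refl , a+b≡m+2 , _) (refl , a′+b′≡m+2 , _) (a≤a′ , b≤b′ , _)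
  with ≤-≤-+-≡⇒≡ a≤a′ b≤b′ (trans a+b≡m+2 (sym a′+b′≡m+2))
... | refl , refl = refl

theorem5p8 : (p : ℕ) → Prime p → (m : ℕ) → 0 < m →
    ((μ : Mult) → InB p m μ ⇔ Minimal (InΛ∖Γ p m) μ) ×
    ((μ : Mult) → InΛ∖Γ p m μ ⇔ InU m (InB p m) μ)
theorem5p8 p _ m _ =
  antichain⇔minimal m (InB p m) (InΛ∖Γ p m) (λ _ → proj₁) (B-antichain p m) (∉Γ⇔aboveB m) ,
  ∉Γ⇔aboveB m
  where open Modulo p
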